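{- For positive integers $m$ and $k$, let $H$ be any graph obtained from $K_m$ by deleting $k-2$ edges. Then $\bar{R}(m;k)\le R(H;k)$.
   Context: For a positive integer $n$, $[n]=\{1,\dots,n\}$. An edge-coloring of $K_n$ with $k$ colors is a map $f:\binom{[n]}{2}\to[k]$; $f^{ -1}(i)$ is the graph on $[n]$ whose edges are the pairs of color $i$, and $\alpha_i(f)$ its independence number. $\bar{R}(m_1,\dots,m_k)$ is the least positive integer $n$ such that every edge-coloring $f$ of $K_n$ with $k$ colors has some $i$ with $\alpha_i(f)\ge m_i$; $\bar{R}(m;k)$ denotes $\bar{R}(m,\dots,m)$ with $k$ arguments. For a graph $H$, the generalized Ramsey number $R(H;k)$ is the least positive integer $n$ such that for every edge-coloring $f$ of $K_n$ with $k$ colors there exists $i\in[k]$ such that $f^{ -1}(i)$ contains a subgraph isomorphic to $H$. -}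

module Defs where

open import Data.Nat using (ℕ; _≤_; _+_)
open import Data.Fin using (Fin) renaming (_<_ to _<ᶠ_)
open import Data.Product using (Σ; _×_; _,_; ∃)
open import Data.List using (List; length)
open import Data.List.Membership.Propositional using (_∈_)
open import Data.List.Relation.Unary.Unique.Propositional using (Unique)
open import Data.List.Relation.Unary.All using (All)
open import Relation.Binary.PropositionalEquality using (_≡_; _≢_)
open import Relation.Nullary using (¬_)
open import Function.Definitions using (Injective)

-- An edge-coloring of K_n with k colors: the colour of the edge {i,j} (i ≠ j)
-- is f i j; symmetry makes it a function of the unordered pair.
-- Values on the diagonal are never used.
record Coloring (n k : ℕ) : Set where
  field
    col  : Fin n → Fin n → Fin k
    symm : ∀ i j → col i j ≡ col j i
open Coloring public

Graph : ℕ → Set₁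
Graph p = Fin p → Fin p → Set

IndepAtLeast : ∀ {n k} → Coloring n k → Fin k → ℕ → Set
IndepAtLeast {n} f c m =
  Σ (Fin m → Fin n) λ g → Injective _≡_ _≡_ g ×
    (∀ a b → a ≢ b → col f (g a) (g b) ≢ c)

ContainsMono : ∀ {n k p} → Coloring n k → Fin k → Graph p → Set
ContainsMono {n} {p = p} f c H =
  Σ (Fin p → Fin n) λ g → Injective _≡_ _≡_ g ×
    (∀ a b → H a b → col f (g a) (g b) ≡ c)

RbarProp : ℕ → ℕ → ℕ → Set
RbarProp m k n = (f : Coloring n k) → ∃ λ (c : Fin k) → IndepAtLeast f c m

RProp : ∀ {p} → Graph p → ℕ → ℕ → Set
RProp H k n = (f : Coloring n k) → ∃ λ (c : Fin k) → ContainsMono f c H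

IsLeastPos : (ℕ → Set) → ℕ → Set
IsLeastPos P n = 1 ≤ n × P n × (∀ n′ → 1 ≤ n′ → P n′ → n ≤ n′)

-- Graph obtained from K_m by deleting the edges listed in D,
-- each edge {a,b} listed once as the pair (a , b) with a < b.
KmMinus : (m : ℕ) → List (Fin m × Fin m) → Graph m
KmMinus m D a b = a ≢ b × ¬ ((a , b) ∈ D) × ¬ ((b , a) ∈ D)

EdgeList : (m d : ℕ) → List (Fin m × Fin m) → Set
EdgeList m d D = All (λ e → Data.Product.proj₁ e <ᶠ Data.Product.proj₂ e) D × Unique D × length D ≡ d

-- A copy of H = K_m minus the edges D in colour c leaves at most |D| + 1 = k − 1 colours in use
-- on its vertex set: c on the edges of H, and one colour per deleted edge. A remaining colour c′
-- is missing on all edges among these m vertices, so they form an independent set of colour c′.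
-- Hence every n with the property defining R(H;k) also has the one defining R̄(m;k).
module Submission where

open import Defs
open import Data.Nat using (ℕ; _≤_; _+_; _<_)
open import Data.Nat.Properties using (≤-reflexive; +-comm)
open import Data.Fin using (Fin)
open import Data.Fin.Properties using (pigeonhole; ¬∀⟶∃¬; ≡-setoid)
import Data.Fin.Properties as Fin
open import Data.Product using (_×_; _,_; ∃)
open import Data.Product.Properties using (≡-dec)
open import Data.List using (List; _∷_; length; map)
open import Data.List.Properties using (length-map)
open import Data.List.Membership.Propositional using (_∈_; _∉_)
open import Data.List.Membership.Propositional.Properties using (∈-map⁺)
import Data.List.Membership.DecPropositional as DecMembership
open import Data.List.Membership.Setoid.Properties using (index-injective)
open import Data.List.Relation.Unary.Any using (here; there; index)
open import Function using (_∘_)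
open import Relation.Binary.PropositionalEquality using (_≡_; _≢_; sym; trans; cong; subst)
open import Relation.Nullary using (yes; no; ¬_)

missing-element : ∀ {k} (xs : List (Fin k)) → length xs < k → ∃ λ c → c ∉ xs
missing-element {k} xs |xs|<k = ¬∀⟶∃¬ k (_∈ xs) (λ c → DecMembership._∈?_ Fin._≟_ c xs) not-all-listed
  where
  not-all-listed : ¬ (∀ c → c ∈ xs)
  not-all-listed c∈xs with i , j , i<j , same-index ← pigeonhole |xs|<k (index ∘ c∈xs)
    = Fin.<⇒≢ i<j (index-injective (≡-setoid k) (c∈xs i) (c∈xs j) same-index)

colourUnder : ∀ {m n k} → Coloring n k → (Fin m → Fin n) → Fin m × Fin m → Fin k
colourUnder f g (a , b) = col f (g a) (g b)

mono-KmMinus⇒independent : ∀ {m n k} (f : Coloring n k) (D : List (Fin m × Fin m))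
  {c c′ : Fin k} (g : Fin m → Fin n) →
  (∀ a b → KmMinus m D a b → col f (g a) (g b) ≡ c) →
  c′ ∉ c ∷ map (colourUnder f g) D →
  ∀ a b → a ≢ b → col f (g a) (g b) ≢ c′
mono-KmMinus⇒independent f D g mono c′∉ a b a≢b ≡c′ with (a , b) ∈? D | (b , a) ∈? D
  where open DecMembership (≡-dec Fin._≟_ Fin._≟_) using (_∈?_)
... | yes ab∈D | _ = c′∉ (there (subst (_∈ _) ≡c′ (∈-map⁺ (colourUnder f g) ab∈D)))
... | no _ | yes ba∈D =
  c′∉ (there (subst (_∈ _) (trans (symm f (g b) (g a)) ≡c′) (∈-map⁺ (colourUnder f g) ba∈D)))
... | no ab∉D | no ba∉D = c′∉ (here (trans (sym ≡c′) (mono a b (a≢b , ab∉D , ba∉D))))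

RProp⇒RbarProp : ∀ {m k} (D : List (Fin m × Fin m)) → 2 + length D ≤ k →
  ∀ n → RProp (KmMinus m D) k n → RbarProp m k n
RProp⇒RbarProp {k = k} D 2+|D|≤k n R f
  with c , g , g-injective , mono ← R f
  with c′ , c′∉ ← missing-element (c ∷ map (colourUnder f g) D)
                    (subst (λ l → 2 + l ≤ k) (sym (length-map (colourUnder f g) D)) 2+|D|≤k)
  = c′ , g , g-injective , mono-KmMinus⇒independent f D g mono c′∉

IsLeastPos-mono : ∀ {P Q : ℕ → Set} {p q} → (∀ n → Q n → P n) →
  IsLeastPos P p → IsLeastPos Q q → p ≤ q
IsLeastPos-mono Q⇒P (_ , _ , p-least) (1≤q , Qq , _) = p-least _ 1≤q (Q⇒P _ Qq)

lemma2p5 : (m k : ℕ) → 1 ≤ m → 1 ≤ k →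
    (D : List (Fin m × Fin m)) → (d : ℕ) → d + 2 ≡ k → EdgeList m d D →
    (r̄ r : ℕ) → IsLeastPos (RbarProp m k) r̄ → IsLeastPos (RProp (KmMinus m D) k) r →
    r̄ ≤ r
lemma2p5 m k _ _ D d d+2≡k (_ , _ , |D|≡d) r̄ r =
  IsLeastPos-mono (RProp⇒RbarProp D (≤-reflexive (trans (cong (2 +_) |D|≡d) (trans (+-comm 2 d) d+2≡k))))
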